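{- Let $k,\ell\ge 3$ be odd, $n=\frac{k\ell+1}{2}$, and let $D_0,\dots,D_{n-1}$ be a partition of the edges of $BW_{k,\ell}$ into $n$ plane subgraphs. Then for each pair $\mathcal{G},\mathcal{G}'$ of opposite groups and each $1\le i\le \ell$, there are at least $i$ diagonal edges connecting $\mathcal{G}$ and $\mathcal{G}'$ of distance at least $d_i=\frac{k+1}{2}\ell-i$ each of which is maximal in the subgraph $D_j$ containing it.
   Context: A geometric graph has vertices as points in general position and straight-line edges; it is plane if no two edges share a point of their relative interiors. For odd $k,\ell\ge 3$, $BW_{k,\ell}$ is the complete geometric graph on $k\ell+1$ points: a center $v_0$ and $k$ groups $\mathcal{G}_1,\dots,\mathcal{G}_k$ (clockwise, indices mod $k$) of $\ell$ points each, where group $\mathcal{G}_i$ consists of $\ell$ points that are $\varepsilon$-close (sufficiently small $\varepsilon>0$) to the $i$-th vertex of a regular $k$-gon centered at $v_0$, all points other than $v_0$ are in convex position on the convex hull, and the convex hull of any $\frac{k+1}{2}$ consecutive groups does not contain $v_0$. Edges incident to $v_0$ are radial; edges between hull-consecutive vertices are boundary edges; all others are diagonal. For a non-radial edge $e$, $e^-$ is the open halfplane bounded by the line through $e$ not containing $v_0$; an edge lies in $e^-$ if its relative interior does. For non-radial edges, $e<_cf$ if $e$ lies in $f^-$. A non-radial edge $e$ is maximal in a subgraph $D$ if there is no non-radial edge $e'$ of $D$ with $e<_ce'$. The distance $\operatorname{dist}(e)$ of a non-radial edge $e$ is the number of points of $BW_{k,\ell}$ in $e^-$ plus one. Groups $\mathcal{G}_i,\mathcal{G}_j$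 are opposite if $|i-j|\in\{\frac{k-1}{2},\frac{k+1}{2}\}$. -}

module Defs where

open import Data.Nat.Base using (ℕ; zero; suc; _+_; _*_; _∸_; _≤_; _<_; _<ᵇ_; _≤ᵇ_; ⌊_/2⌋; ∣_-_∣)
open import Data.Bool.Base using (Bool; true; false; _∧_; _∨_; T; if_then_else_)
open import Data.Fin.Base using (Fin; toℕ)
open import Data.List.Base using (List; []; _∷_; allFin; cartesianProduct)
open import Data.Product.Base using (Σ; ∃; _×_; _,_; proj₁; proj₂)
open import Data.Sum.Base using (_⊎_)
open import Data.Empty using (⊥)
open import Data.Unit.Base using (⊤)
open import Relation.Nullary using (¬_)
open import Relation.Binary.PropositionalEquality using (_≡_)

Odd : ℕ → Set
Odd k = ∃ λ m → k ≡ suc (2 * m)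

-- Combinatorial model of the order type of BW_{k,ℓ}.
-- Hull points are pairs (g , t): the t-th point (clockwise) of group G_g;
-- its clockwise position on the convex hull is g * ℓ + t  (0 ≤ … < k ℓ).
module BW (k ℓ : ℕ) where

  N : ℕ
  N = k * ℓ

  n : ℕ
  n = ⌊ k * ℓ + 1 /2⌋

  h : ℕ
  h = ⌊ k /2⌋

  Pt : Set
  Pt = Fin k × Fin ℓ

  group : Pt → ℕ
  group p = toℕ (proj₁ p)

  idx : Pt → ℕ
  idx (g , t) = toℕ g * ℓ + toℕ t

  allPts : List Pt
  allPts = cartesianProduct (allFin k) (allFin ℓ)

  -- Edges of the complete geometric graph on center v₀ plus the k ℓ hull
  -- points: radial edges v₀p, and chords pq stored with idx p < idx q.
  data Edge : Set where
    radial : Pt → Edge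
    chord  : (p q : Pt) → idx p < idx q → Edge

  gd : Pt → Pt → ℕ
  gd p q = group q ∸ group p

  -- inMinus p q z : the hull point with position z lies in e⁻ for e = pq
  -- (idx p < idx q).  If the clockwise group distance from p to q is at most
  -- (k-1)/2, e⁻ contains exactly the hull points strictly clockwise between
  -- p and q; otherwise exactly those strictly clockwise between q and p.
  -- (v₀ itself never lies in e⁻.)
  inMinus : Pt → Pt → ℕ → Bool
  inMinus p q z =
    if gd p q ≤ᵇ h
    then ((idx p <ᵇ z) ∧ (z <ᵇ idx q))
    else ((idx q <ᵇ z) ∨ (z <ᵇ idx p))

  count : (Pt → Bool) → List Pt → ℕ
  count P [] = 0
  count P (x ∷ xs) = if P x then suc (count P xs) else count P xs

  dist : Edge → ℕ
  dist (radial _)    = 0   -- not used: dist is only defined for non-radial edges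
  dist (chord p q _) = suc (count (λ z → inMinus p q (idx z)) allPts)

  -- Crossing: relative interiors share a point.
  Cross : Edge → Edge → Set
  Cross (radial _)    (radial _)    = ⊥
  Cross (radial r)    (chord p q _) = T (inMinus p q (idx r))
  Cross (chord p q _) (radial r)    = T (inMinus p q (idx r))
  Cross (chord p q _) (chord r s _) =
      (idx p < idx r × idx r < idx q × idx q < idx s)
    ⊎ (idx r < idx p × idx p < idx s × idx s < idx q)

  NonRadial : Edge → Set
  NonRadial (radial _)    = ⊥
  NonRadial (chord _ _ _) = ⊤

  Boundary : Edge → Set
  Boundary (radial _)    = ⊥
  Boundary (chord p q _) = (idx q ≡ suc (idx p)) ⊎ (idx p ≡ 0 × suc (idx q) ≡ N)

  Diagonal : Edge → Set
  Diagonal e = NonRadial e × ¬ Boundary e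

  InClosedMinus : Pt → Pt → ℕ → Set
  InClosedMinus r s z = (z ≡ idx r) ⊎ (z ≡ idx s) ⊎ T (inMinus r s z)

  -- e <_c f : (non-radial) e lies in f⁻, i.e. the relative interior of e is in
  -- the open halfplane f⁻; for hull chords this holds iff both endpoints of e
  -- lie in the closed halfplane and e ≠ f.
  _<c_ : Edge → Edge → Set
  radial _    <c _            = ⊥
  chord _ _ _ <c radial _     = ⊥
  chord p q _ <c chord r s _  =
    InClosedMinus r s (idx p) × InClosedMinus r s (idx q)
    × ¬ (idx p ≡ idx r × idx q ≡ idx s)

  Maximal : {m : ℕ} → (Edge → Fin m) → Edge → Set
  Maximal c e = ¬ (Σ Edge λ e' → NonRadial e' × c e' ≡ c e × e <c e')

  PlaneColouring : {m : ℕ} → (Edge → Fin m) → Set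
  PlaneColouring c = ∀ e f → c e ≡ c f → ¬ Cross e f

  Opposite : Fin k → Fin k → Set
  Opposite a b = (∣ toℕ a - toℕ b ∣ ≡ h) ⊎ (∣ toℕ a - toℕ b ∣ ≡ suc h)

  Connects : Fin k → Fin k → Edge → Set
  Connects a b (radial _)    = ⊥
  Connects a b (chord p q _) =
    (proj₁ p ≡ a × proj₁ q ≡ b) ⊎ (proj₁ p ≡ b × proj₁ q ≡ a)

{-# OPTIONS --safe #-}
-- Write h = (k - 1)/2.  The ℓ² chords joining two opposite groups form a grid indexed by the
-- offsets (t , s) of their endpoints, arranged so that dist = hℓ + s - t, two chords whose indices
-- both increase cross, and a chord is below (<c) another chord only if that one is a grid chord
-- whose index interval [t , s] strictly contains its own.  The i seed chords (j , ℓ - i + j),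
-- j < i, pairwise cross and so lie in distinct plane subgraphs.  Climbing from each seed through
-- ever wider intervals to a maximal chord of the same colour keeps t ≤ j and s ≥ ℓ - i + j, hence
-- distance at least (h + 1)ℓ - i; the chords reached are maximal, and distinct because their
-- colours are.

module Submission where

open import Defs
open import Data.Bool.Base using (Bool; true; false; _∧_; _∨_; T)
open import Data.Bool.Properties using (T-≡; T-∧; T-∨)
open import Data.Fin.Base as F using (Fin; toℕ; fromℕ<; inject≤)
open import Data.Fin.Properties as FP using (toℕ<n; toℕ-injective; toℕ-fromℕ<; toℕ-inject≤; any?)
open import Data.List.Base using (List; []; _∷_; _++_; map; tabulate; allFin; cartesianProduct)
open import Data.List.Properties using (map-tabulate)
open import Data.Nat.Base
  using (ℕ; zero; suc; _+_; _*_; _∸_; _≤_; _<_; _<ᵇ_; z≤n; s≤s; s≤s⁻¹; z<s; s<s; ⌊_/2⌋; ∣_-_∣)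
open import Data.Nat.Induction using (<-wellFounded)
open import Data.Nat.Properties
open import Algebra.Properties.CommutativeSemigroup +-commutativeSemigroup using (interchange; x∙yz≈y∙xz)
open import Data.Product.Base using (Σ; ∃; _×_; _,_; proj₁; proj₂)
open import Data.Product.Properties using (≡-dec)
open import Data.Sum.Base using (_⊎_; inj₁; inj₂; swap) renaming (map to map-⊎)
open import Data.Unit.Base using (tt)
open import Function.Base using (_∘_)
open import Function.Bundles using (Equivalence)
open import Function.Definitions using (Injective)
open import Induction.WellFounded using (Acc; acc)
open import Relation.Binary.Construct.On as On using ()
open import Relation.Binary.Definitions using (tri<; tri≈; tri>)
open import Relation.Binary.PropositionalEquality
  using (_≡_; _≢_; refl; sym; trans; cong; cong₂; subst; subst₂; module ≡-Reasoning)
open import Relation.Nullary using (¬_; Dec; yes; no; ¬?; contradiction)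
open import Relation.Nullary.Decidable using (_×-dec_; map′)

module Ascent {A : Set} (_⊑_ : A → A → Set)
  (⊑-refl : ∀ {x} → x ⊑ x) (⊑-trans : ∀ {x y z} → x ⊑ y → y ⊑ z → x ⊑ z)
  (μ : A → ℕ) (μ-anti : ∀ {x y} → x ⊑ y → x ≢ y → μ y < μ x) where

  _⊏_ : A → A → Set
  x ⊏ y = x ⊑ y × x ≢ y

  ascend : {P : A → Set} → (∀ x → Dec (∃ λ y → x ⊏ y × P y)) →
    ∀ {x} → P x → ∃ λ y → x ⊑ y × P y × ¬ (∃ λ z → y ⊏ z × P z)
  ascend {P} above? {x} px = go (On.wellFounded μ <-wellFounded x) px
    where
    go : ∀ {x} → Acc (λ y z → μ y < μ z) x → P x → ∃ λ y → x ⊑ y × P y × ¬ (∃ λ z → y ⊏ z × P z)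
    go {x} (acc rs) px with above? x
    ... | no top = x , ⊑-refl , px , top
    ... | yes (y , (x⊑y , x≢y) , py) with go (rs (μ-anti x⊑y x≢y)) py
    ...   | z , y⊑z , pz , top = z , ⊑-trans x⊑y y⊑z , pz , top

module Intervals (n : ℕ) where

  _⊑_ : Fin n × Fin n → Fin n × Fin n → Set
  (t , s) ⊑ (t′ , s′) = toℕ t′ ≤ toℕ t × toℕ s ≤ toℕ s′

  slack : Fin n × Fin n → ℕ
  slack (t , s) = toℕ t + (n ∸ toℕ s)

  slack-< : ∀ {x y} → x ⊑ y → x ≢ y → slack y < slack x
  slack-< {t , s} {t′ , s′} (t′≤t , s≤s′) x≢y with m≤n⇒m<n∨m≡n t′≤t
  ... | inj₁ t′<t = +-mono-<-≤ t′<t (∸-monoʳ-≤ n s≤s′)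
  ... | inj₂ t′≡t = +-mono-≤-< (≤-reflexive t′≡t) (∸-monoʳ-< s<s′ (<⇒≤ (toℕ<n s′)))
    where
    s<s′ : toℕ s < toℕ s′
    s<s′ = ≤∧≢⇒< s≤s′ λ s≡s′ → x≢y (cong₂ _,_ (toℕ-injective (sym t′≡t)) (toℕ-injective s≡s′))

  open Ascent _⊑_ (≤-refl , ≤-refl) (λ (a , b) (c , d) → ≤-trans c a , ≤-trans b d) slack slack-< public

  _⊏?_ : ∀ x y → Dec (x ⊏ y)
  (t , s) ⊏? (t′ , s′) =
    ((toℕ t′ ≤? toℕ t) ×-dec (toℕ s ≤? toℕ s′)) ×-dec ¬? (≡-dec FP._≟_ FP._≟_ (t , s) (t′ , s′))

  ∃-interval? : {Q : Fin n × Fin n → Set} → (∀ x → Dec (Q x)) → Dec (∃ Q)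
  ∃-interval? Q? = map′ (λ (t , s , q) → (t , s) , q) (λ ((t , s) , q) → t , s , q)
                        (any? λ t → any? λ s → Q? (t , s))

indicator : Bool → ℕ
indicator true  = 1
indicator false = 0

countBelow : (ℕ → Bool) → ℕ → ℕ
countBelow f zero    = 0
countBelow f (suc n) = indicator (f 0) + countBelow (f ∘ suc) n

countBelow-+ : ∀ m {n} f → countBelow f (m + n) ≡ countBelow f m + countBelow (f ∘ (m +_)) n
countBelow-+ zero    f = refl
countBelow-+ (suc m) f = trans (cong (indicator (f 0) +_) (countBelow-+ m (f ∘ suc)))
                               (sym (+-assoc (indicator (f 0)) _ _))

countBelow-pointwise : ∀ {n} f g f′ g′ →
  (∀ z → z < n → indicator (f z) + indicator (g z) ≡ indicator (f′ z) + indicator (g′ z)) →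
  countBelow f n + countBelow g n ≡ countBelow f′ n + countBelow g′ n
countBelow-pointwise {zero}  _ _ _ _ eq = refl
countBelow-pointwise {suc n} f g f′ g′ eq = begin
  (indicator (f 0) + countBelow (f ∘ suc) n) + (indicator (g 0) + countBelow (g ∘ suc) n)
    ≡⟨ interchange (indicator (f 0)) (countBelow (f ∘ suc) n) (indicator (g 0)) (countBelow (g ∘ suc) n) ⟩
  (indicator (f 0) + indicator (g 0)) + (countBelow (f ∘ suc) n + countBelow (g ∘ suc) n)
    ≡⟨ cong₂ _+_ (eq 0 z<s)
                 (countBelow-pointwise (f ∘ suc) (g ∘ suc) (f′ ∘ suc) (g′ ∘ suc) (λ z z<n → eq (suc z) (s<s z<n))) ⟩
  (indicator (f′ 0) + indicator (g′ 0)) + (countBelow (f′ ∘ suc) n + countBelow (g′ ∘ suc) n)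
    ≡⟨ interchange (indicator (f′ 0)) (indicator (g′ 0)) (countBelow (f′ ∘ suc) n) (countBelow (g′ ∘ suc) n) ⟩
  (indicator (f′ 0) + countBelow (f′ ∘ suc) n) + (indicator (g′ 0) + countBelow (g′ ∘ suc) n) ∎
  where open ≡-Reasoning

countBelow-<ᵇ : ∀ {y n} → y ≤ n → countBelow (_<ᵇ y) n ≡ y
countBelow-<ᵇ {n = zero}  z≤n       = refl
countBelow-<ᵇ {n = suc n} z≤n       = countBelow-<ᵇ {n = n} z≤n
countBelow-<ᵇ             (s≤s y≤n) = cong suc (countBelow-<ᵇ y≤n)

true-if-T : ∀ {b} → T b → b ≡ true
true-if-T = Equivalence.to T-≡

false-if-¬T : ∀ {b} → ¬ T b → b ≡ false
false-if-¬T {true}  ¬t = contradiction tt ¬t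
false-if-¬T {false} _  = refl

<ᵇ-true : ∀ {m n} → m < n → (m <ᵇ n) ≡ true
<ᵇ-true = true-if-T ∘ <⇒<ᵇ

<ᵇ-false : ∀ {m n} → n ≤ m → (m <ᵇ n) ≡ false
<ᵇ-false n≤m = false-if-¬T λ m<n → <⇒≱ (<ᵇ⇒< _ _ m<n) n≤m

countBelow-between : ∀ {x y n} → x < y → y ≤ n →
  suc x + countBelow (λ z → (x <ᵇ z) ∧ (z <ᵇ y)) n ≡ y
countBelow-between {x} {y} {n} x<y y≤n = begin
  suc x + countBelow between n
    ≡⟨ cong (_+ countBelow between n) (countBelow-<ᵇ (≤-trans x<y y≤n)) ⟨
  countBelow (_<ᵇ suc x) n + countBelow between n
    ≡⟨ countBelow-pointwise {n} (_<ᵇ suc x) between (_<ᵇ y) (_<ᵇ 0) (λ z _ → pointwise z) ⟩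
  countBelow (_<ᵇ y) n + countBelow (_<ᵇ 0) n
    ≡⟨ cong₂ _+_ (countBelow-<ᵇ y≤n) (countBelow-<ᵇ {n = n} z≤n) ⟩
  y + 0
    ≡⟨ +-identityʳ y ⟩
  y ∎
  where
  open ≡-Reasoning
  between : ℕ → Bool
  between z = (x <ᵇ z) ∧ (z <ᵇ y)
  pointwise : ∀ z → indicator (z <ᵇ suc x) + indicator (between z) ≡ indicator (z <ᵇ y) + indicator (z <ᵇ 0)
  pointwise z with z ≤? x | z <? y
  ... | yes z≤x | _ rewrite <ᵇ-true (s≤s z≤x) | <ᵇ-false z≤x | <ᵇ-true (≤-<-trans z≤x x<y) = refl
  ... | no z≰x | yes z<y rewrite <ᵇ-false (≰⇒> z≰x) | <ᵇ-true (≰⇒> z≰x) | <ᵇ-true z<y = refl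
  ... | no z≰x | no z≮y rewrite <ᵇ-false (≰⇒> z≰x) | <ᵇ-true (≰⇒> z≰x) | <ᵇ-false (≮⇒≥ z≮y) = refl

countBelow-outside : ∀ {x y n} → x < y → y < n →
  countBelow (λ z → (y <ᵇ z) ∨ (z <ᵇ x)) n + suc y ≡ x + n
countBelow-outside {x} {y} {n} x<y y<n = begin
  countBelow outside n + suc y
    ≡⟨ cong (countBelow outside n +_) (countBelow-<ᵇ y<n) ⟨
  countBelow outside n + countBelow (_<ᵇ suc y) n
    ≡⟨ countBelow-pointwise outside (_<ᵇ suc y) (_<ᵇ x) (_<ᵇ n) pointwise ⟩
  countBelow (_<ᵇ x) n + countBelow (_<ᵇ n) n
    ≡⟨ cong₂ _+_ (countBelow-<ᵇ (<⇒≤ (<-trans x<y y<n))) (countBelow-<ᵇ ≤-refl) ⟩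
  x + n ∎
  where
  open ≡-Reasoning
  outside : ℕ → Bool
  outside z = (y <ᵇ z) ∨ (z <ᵇ x)
  pointwise : ∀ z → z < n → indicator (outside z) + indicator (z <ᵇ suc y) ≡ indicator (z <ᵇ x) + indicator (z <ᵇ n)
  pointwise z z<n rewrite <ᵇ-true z<n with z <? x | z ≤? y
  ... | yes z<x | _ rewrite <ᵇ-false (<⇒≤ (<-trans z<x x<y)) | <ᵇ-true z<x | <ᵇ-true (s≤s (<⇒≤ (<-trans z<x x<y))) = refl
  ... | no z≮x | yes z≤y rewrite <ᵇ-false z≤y | <ᵇ-false (≮⇒≥ z≮x) | <ᵇ-true (s≤s z≤y) = refl
  ... | no z≮x | no z≰y rewrite <ᵇ-true (≰⇒> z≰y) | <ᵇ-false (≮⇒≥ z≮x) | <ᵇ-false (≰⇒> z≰y) = refl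

squeeze : ∀ {x y z d} → x ≤ y → y + d ≤ z → z ≤ x + d → x ≡ y × z ≡ x + d
squeeze {x} {y} {z} {d} x≤y y+d≤z z≤x+d = x≡y , ≤-antisym z≤x+d (subst (λ w → w + d ≤ z) (sym x≡y) y+d≤z)
  where
  x≡y : x ≡ y
  x≡y = ≤-antisym x≤y (+-cancelʳ-≤ d y x (≤-trans y+d≤z z≤x+d))

straddle : ∀ {h d g₀ g₁} → h ≤ d → g₁ ≡ g₀ + d → g₁ ≤ h + h → g₀ ≤ h × h ≤ g₁
straddle {h} {d} {g₀} {g₁} h≤d g₁≡ g₁≤2h =
  +-cancelʳ-≤ h g₀ h (≤-trans (+-monoʳ-≤ g₀ h≤d) (subst (_≤ h + h) g₁≡ g₁≤2h)) ,
  ≤-trans h≤d (subst (d ≤_) (sym g₁≡) (m≤n+m d g₀))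

∣m-n∣≡d⇒n≡m+d : ∀ {m n d} → m ≤ n → ∣ m - n ∣ ≡ d → n ≡ m + d
∣m-n∣≡d⇒n≡m+d {m} m≤n ∣m-n∣≡d =
  trans (sym (m+[n∸m]≡n m≤n)) (cong (m +_) (trans (sym (m≤n⇒∣m-n∣≡n∸m m≤n)) ∣m-n∣≡d))

⌊1+n+n/2⌋≡n : ∀ n → ⌊ suc (n + n) /2⌋ ≡ n
⌊1+n+n/2⌋≡n zero    = refl
⌊1+n+n/2⌋≡n (suc n) = cong suc (trans (cong ⌊_/2⌋ (+-suc n n)) (⌊1+n+n/2⌋≡n n))

odd⇒≡1+2⌊/2⌋ : ∀ {k} → Odd k → k ≡ suc (⌊ k /2⌋ + ⌊ k /2⌋)
odd⇒≡1+2⌊/2⌋ (n , refl) = cong suc (begin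
  n + (n + 0)                                    ≡⟨ cong (n +_) (+-identityʳ n) ⟩
  n + n                                          ≡⟨ cong₂ _+_ half half ⟨
  ⌊ suc (2 * n) /2⌋ + ⌊ suc (2 * n) /2⌋          ∎)
  where
  open ≡-Reasoning
  half : ⌊ suc (2 * n) /2⌋ ≡ n
  half = trans (cong (λ m → ⌊ suc (n + m) /2⌋) (+-identityʳ n)) (⌊1+n+n/2⌋≡n n)

3≤1+n+n⇒1≤n : ∀ n → 3 ≤ suc (n + n) → 1 ≤ n
3≤1+n+n⇒1≤n zero    (s≤s ())
3≤1+n+n⇒1≤n (suc n) _ = s≤s z≤n

module Geometry (k ℓ : ℕ) where
  open BW k ℓ

  count-∷ : ∀ P x xs → count P (x ∷ xs) ≡ indicator (P x) + count P xs
  count-∷ P x xs with P x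
  ... | true  = refl
  ... | false = refl

  count-++ : ∀ P xs ys → count P (xs ++ ys) ≡ count P xs + count P ys
  count-++ P []       ys = refl
  count-++ P (x ∷ xs) ys = begin
    count P (x ∷ xs ++ ys)                       ≡⟨ count-∷ P x (xs ++ ys) ⟩
    indicator (P x) + count P (xs ++ ys)         ≡⟨ cong (indicator (P x) +_) (count-++ P xs ys) ⟩
    indicator (P x) + (count P xs + count P ys)  ≡⟨ +-assoc (indicator (P x)) _ _ ⟨
    indicator (P x) + count P xs + count P ys    ≡⟨ cong (_+ count P ys) (count-∷ P x xs) ⟨
    count P (x ∷ xs) + count P ys                ∎
    where open ≡-Reasoning

  count-tabulate : ∀ {m} P f (H : Fin m → Pt) → (∀ t → P (H t) ≡ f (toℕ t)) →
    count P (tabulate H) ≡ countBelow f m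
  count-tabulate {zero}  P f H eq = refl
  count-tabulate {suc m} P f H eq = trans (count-∷ P (H F.zero) (tabulate (H ∘ F.suc)))
    (cong₂ _+_ (cong indicator (eq F.zero)) (count-tabulate P (f ∘ suc) (H ∘ F.suc) (eq ∘ F.suc)))

  count-rows : ∀ {m} P f (G : Fin m → Fin k) → (∀ g t → P (G g , t) ≡ f (toℕ g * ℓ + toℕ t)) →
    count P (cartesianProduct (tabulate G) (allFin ℓ)) ≡ countBelow f (m * ℓ)
  count-rows {zero}  P f G eq = refl
  count-rows {suc m} P f G eq = begin
    count P (map (G F.zero ,_) (allFin ℓ) ++ rest)         ≡⟨ count-++ P (map (G F.zero ,_) (allFin ℓ)) rest ⟩
    count P (map (G F.zero ,_) (allFin ℓ)) + count P rest  ≡⟨ cong₂ _+_ first (count-rows P (f ∘ (ℓ +_)) (G ∘ F.suc) shifted) ⟩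
    countBelow f ℓ + countBelow (f ∘ (ℓ +_)) (m * ℓ)       ≡⟨ countBelow-+ ℓ f ⟨
    countBelow f (ℓ + m * ℓ)                               ∎
    where
    open ≡-Reasoning
    rest : List Pt
    rest = cartesianProduct (tabulate (G ∘ F.suc)) (allFin ℓ)
    first : count P (map (G F.zero ,_) (allFin ℓ)) ≡ countBelow f ℓ
    first = trans (cong (count P) (map-tabulate (λ t → t) (G F.zero ,_))) (count-tabulate P f (G F.zero ,_) (eq F.zero))
    shifted : ∀ g t → P (G (F.suc g) , t) ≡ f (ℓ + (toℕ g * ℓ + toℕ t))
    shifted g t = trans (eq (F.suc g) t) (cong f (+-assoc ℓ (toℕ g * ℓ) (toℕ t)))

  count-allPts : ∀ P f → (∀ x → P x ≡ f (idx x)) → count P allPts ≡ countBelow f (k * ℓ)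
  count-allPts P f eq = count-rows P f (λ g → g) λ g t → eq (g , t)

  idx<suc[group]*ℓ : ∀ x → idx x < suc (group x) * ℓ
  idx<suc[group]*ℓ (g , t) = subst (toℕ g * ℓ + toℕ t <_) (+-comm (toℕ g * ℓ) ℓ) (+-monoʳ-< (toℕ g * ℓ) (toℕ<n t))

  group*ℓ≤idx : ∀ x → group x * ℓ ≤ idx x
  group*ℓ≤idx (g , t) = m≤m+n (toℕ g * ℓ) (toℕ t)

  group<⇒idx< : ∀ {x y} → group x < group y → idx x < idx y
  group<⇒idx< {x} {y} gx<gy = begin-strict
    idx x              <⟨ idx<suc[group]*ℓ x ⟩
    suc (group x) * ℓ  ≤⟨ *-monoˡ-≤ ℓ gx<gy ⟩
    group y * ℓ        ≤⟨ group*ℓ≤idx y ⟩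
    idx y              ∎
    where open ≤-Reasoning

  idx≤⇒group≤ : ∀ {x y} → idx x ≤ idx y → group x ≤ group y
  idx≤⇒group≤ x≤y = ≮⇒≥ λ gy<gx → <⇒≱ (group<⇒idx< gy<gx) x≤y

  idx<N : ∀ x → idx x < k * ℓ
  idx<N x@(g , _) = <-≤-trans (idx<suc[group]*ℓ x) (*-monoˡ-≤ ℓ (toℕ<n g))

  -- A chord pq is near when gd p q ≤ h (then e⁻ is the arc from p to q) and far otherwise.
  inMinus-near : ∀ p q → gd p q ≤ h → ∀ z → inMinus p q z ≡ ((idx p <ᵇ z) ∧ (z <ᵇ idx q))
  inMinus-near p q near z rewrite true-if-T (≤⇒≤ᵇ near) = refl

  inMinus-far : ∀ p q → h < gd p q → ∀ z → inMinus p q z ≡ ((idx q <ᵇ z) ∨ (z <ᵇ idx p))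
  inMinus-far p q far z rewrite false-if-¬T (<⇒≱ far ∘ ≤ᵇ⇒≤ (gd p q) h) = refl

  closedMinus-near : ∀ r q {z} → idx r < idx q → gd r q ≤ h → InClosedMinus r q z → idx r ≤ z × z ≤ idx q
  closedMinus-near r q r<q near (inj₁ refl)        = ≤-refl , <⇒≤ r<q
  closedMinus-near r q r<q near (inj₂ (inj₁ refl)) = <⇒≤ r<q , ≤-refl
  closedMinus-near r q {z} r<q near (inj₂ (inj₂ z∈)) with Equivalence.to T-∧ (subst T (inMinus-near r q near z) z∈)
  ... | r<z , z<q = <⇒≤ (<ᵇ⇒< _ _ r<z) , <⇒≤ (<ᵇ⇒< _ _ z<q)

  closedMinus-far : ∀ r q {z} → h < gd r q → InClosedMinus r q z → z ≤ idx r ⊎ idx q ≤ z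
  closedMinus-far r q far (inj₁ refl)        = inj₁ ≤-refl
  closedMinus-far r q far (inj₂ (inj₁ refl)) = inj₂ ≤-refl
  closedMinus-far r q {z} far (inj₂ (inj₂ z∈)) with Equivalence.to T-∨ (subst T (inMinus-far r q far z) z∈)
  ... | inj₁ q<z = inj₂ (<⇒≤ (<ᵇ⇒< _ _ q<z))
  ... | inj₂ z<r = inj₁ (<⇒≤ (<ᵇ⇒< _ _ z<r))

  dist-near : ∀ p q (p<q : idx p < idx q) → gd p q ≤ h → dist (chord p q p<q) + idx p ≡ idx q
  dist-near p q p<q near = begin
    suc (count (λ z → inMinus p q (idx z)) allPts) + idx p
      ≡⟨ cong (λ c → suc c + idx p) (count-allPts _ between (inMinus-near p q near ∘ idx)) ⟩
    suc (countBelow between (k * ℓ)) + idx p                ≡⟨ cong suc (+-comm _ (idx p)) ⟩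
    suc (idx p) + countBelow between (k * ℓ)                ≡⟨ countBelow-between p<q (<⇒≤ (idx<N q)) ⟩
    idx q                                                   ∎
    where
    open ≡-Reasoning
    between : ℕ → Bool
    between z = (idx p <ᵇ z) ∧ (z <ᵇ idx q)

  dist-far : ∀ p q (p<q : idx p < idx q) → h < gd p q → dist (chord p q p<q) + idx q ≡ idx p + k * ℓ
  dist-far p q p<q far = begin
    suc (count (λ z → inMinus p q (idx z)) allPts) + idx q
      ≡⟨ cong (λ c → suc c + idx q) (count-allPts _ outside (inMinus-far p q far ∘ idx)) ⟩
    suc (countBelow outside (k * ℓ)) + idx q                ≡⟨ +-suc _ (idx q) ⟨
    countBelow outside (k * ℓ) + suc (idx q)                ≡⟨ countBelow-outside p<q (idx<N q) ⟩
    idx p + k * ℓ                                           ∎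
    where
    open ≡-Reasoning
    outside : ℕ → Bool
    outside z = (idx q <ᵇ z) ∨ (z <ᵇ idx p)

  near-span : ∀ p q → gd p q ≤ h → group q ≤ group p + h
  near-span p q near = ≤-trans (m≤n+m∸n (group q) (group p)) (+-monoʳ-≤ (group p) near)

  far-span : ∀ p q → idx p < idx q → h < gd p q → group p + h < group q
  far-span p q p<q far =
    <-≤-trans (+-monoʳ-< (group p) far) (≤-reflexive (m+[n∸m]≡n (idx≤⇒group≤ {p} {q} (<⇒≤ p<q))))

  open Intervals ℓ using (_⊑_; _⊏_; _⊏?_; ∃-interval?; ascend)

  Connects-sym : ∀ {a b} e → Connects a b e → Connects b a e
  Connects-sym (chord _ _ _) = swap

  Connects⇒NonRadial : ∀ {a b} e → Connects a b e → NonRadial e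
  Connects⇒NonRadial (chord _ _ _) _ = tt

  record Bundle (a b : Fin k) : Set where
    field
      edge      : Fin ℓ × Fin ℓ → Edge
      connects  : ∀ x → Connects a b (edge x)
      dist-edge : ∀ t s → dist (edge (t , s)) + toℕ t ≡ h * ℓ + toℕ s
      crossing  : ∀ {t s t′ s′} → toℕ t < toℕ t′ → toℕ s < toℕ s′ → Cross (edge (t , s)) (edge (t′ , s′))
      <c-edge   : ∀ x e → edge x <c e → ∃ λ y → x ⊏ y × e ≡ edge y

  Bundle-sym : ∀ {a b} → Bundle a b → Bundle b a
  Bundle-sym B = record { Bundle B; connects = λ x → Connects-sym (edge x) (connects x) }
    where open Bundle B

  LongMaximalDiagonals : ∀ {m} → (Edge → Fin m) → Fin k → Fin k → ℕ → Set
  LongMaximalDiagonals c a b i = Σ (Fin i → Edge) λ f → Injective _≡_ _≡_ f ×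
    ((j : Fin i) → Diagonal (f j) × Connects a b (f j) × (suc h * ℓ ∸ i ≤ dist (f j)) × Maximal c (f j))

  module Opposite (k≡ : k ≡ suc (h + h)) (h≥1 : 1 ≤ h) (ℓ≥2 : 2 ≤ ℓ) where

    hℓ≥2 : 2 ≤ h * ℓ
    hℓ≥2 = *-mono-≤ h≥1 ℓ≥2

    hℓ>0 : 0 < h * ℓ
    hℓ>0 = <-trans z<s hℓ≥2

    N≡ : k * ℓ ≡ suc h * ℓ + h * ℓ
    N≡ = trans (cong (_* ℓ) k≡) (*-distribʳ-+ ℓ (suc h) h)

    group≤2h : ∀ x → group x ≤ h + h
    group≤2h (g , _) = s≤s⁻¹ (subst (toℕ g <_) k≡ (toℕ<n g))

    near-gap : ∀ p q → gd p q ≤ h → idx q < idx p + suc h * ℓ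
    near-gap p q near = begin-strict
      idx q                      <⟨ idx<suc[group]*ℓ q ⟩
      suc (group q) * ℓ          ≤⟨ *-monoˡ-≤ ℓ (s≤s (near-span p q near)) ⟩
      suc (group p + h) * ℓ      ≡⟨ cong (_* ℓ) (+-suc (group p) h) ⟨
      (group p + suc h) * ℓ      ≡⟨ *-distribʳ-+ ℓ (group p) (suc h) ⟩
      group p * ℓ + suc h * ℓ    ≤⟨ +-monoˡ-≤ (suc h * ℓ) (group*ℓ≤idx p) ⟩
      idx p + suc h * ℓ          ∎
      where open ≤-Reasoning

    far-gap : ∀ p q → idx p < idx q → h < gd p q → idx p + h * ℓ < idx q
    far-gap p q p<q far = begin-strict
      idx p + h * ℓ              <⟨ +-monoˡ-< (h * ℓ) (idx<suc[group]*ℓ p) ⟩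
      suc (group p) * ℓ + h * ℓ  ≡⟨ *-distribʳ-+ ℓ (suc (group p)) h ⟨
      suc (group p + h) * ℓ      ≤⟨ *-monoˡ-≤ ℓ (far-span p q p<q far) ⟩
      group q * ℓ                ≤⟨ group*ℓ≤idx q ⟩
      idx q                      ∎
      where open ≤-Reasoning

    boundary⇒dist≡1 : ∀ e → Boundary e → dist e ≡ 1
    boundary⇒dist≡1 (chord p q p<q) (inj₁ q≡1+p) with gd p q ≤? h
    ... | yes near = +-cancelʳ-≡ (idx p) _ 1 (trans (dist-near p q p<q near) q≡1+p)
    ... | no ¬near = contradiction (far-gap p q p<q (≰⇒> ¬near))
                       (≤⇒≯ (subst (_≤ idx p + h * ℓ) (sym q≡1+p) (m<m+n (idx p) hℓ>0)))
    boundary⇒dist≡1 (chord p q p<q) (inj₂ (p≡0 , 1+q≡N)) with gd p q ≤? h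
    ... | yes near = contradiction (subst (idx q <_) (cong (_+ suc h * ℓ) p≡0) (near-gap p q near)) (≤⇒≯ q-large)
      where
      q-large : suc h * ℓ ≤ idx q
      q-large = s≤s⁻¹ (begin
        suc (suc h * ℓ)           ≤⟨ m<m+n (suc h * ℓ) hℓ>0 ⟩
        suc h * ℓ + h * ℓ         ≡⟨ N≡ ⟨
        k * ℓ                     ≡⟨ 1+q≡N ⟨
        suc (idx q)               ∎)
        where open ≤-Reasoning
    ... | no ¬near = +-cancelʳ-≡ (idx q) _ 1 (begin
      dist (chord p q p<q) + idx q  ≡⟨ dist-far p q p<q (≰⇒> ¬near) ⟩
      idx p + k * ℓ                 ≡⟨ cong₂ _+_ p≡0 (sym 1+q≡N) ⟩
      suc (idx q)                   ∎)
      where open ≡-Reasoning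

    straddling : ∀ p q {d} → h ≤ d → group q ≡ group p + d → group p ≤ h × h ≤ group q
    straddling p q h≤d q≡ = straddle h≤d q≡ (group≤2h q)

    far⇒group-start<h : ∀ r q → idx r < idx q → h < gd r q → group r < h
    far⇒group-start<h r q r<q far = +-cancelʳ-< h (group r) h (<-≤-trans (far-span r q r<q far) (group≤2h q))

    far⇒h<group-end : ∀ r q → idx r < idx q → h < gd r q → h < group q
    far⇒h<group-end r q r<q far = ≤-<-trans (m≤n+m h (group r)) (far-span r q r<q far)

    far-closedMinus-straddling : ∀ {p₀ q₀} r q → idx r < idx q → h < gd r q →
      group p₀ ≤ h × h ≤ group q₀ → InClosedMinus r q (idx p₀) → InClosedMinus r q (idx q₀) →
      idx p₀ ≤ idx r × idx q ≤ idx q₀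
    far-closedMinus-straddling {p₀} {q₀} r q r<q far (p₀≤h , h≤q₀) p₀∈ q₀∈
      with closedMinus-far r q far p₀∈ | closedMinus-far r q far q₀∈
    ... | inj₂ q≤p₀ | _         =
      contradiction (≤-trans (idx≤⇒group≤ {q} {p₀} q≤p₀) p₀≤h) (<⇒≱ (far⇒h<group-end r q r<q far))
    ... | inj₁ _    | inj₁ q₀≤r =
      contradiction (≤-trans h≤q₀ (idx≤⇒group≤ {q₀} {r} q₀≤r)) (<⇒≱ (far⇒group-start<h r q r<q far))
    ... | inj₁ p₀≤r | inj₂ q≤q₀ = p₀≤r , q≤q₀

    closedMinus-near-opposite : ∀ p₀ q₀ r q → idx r < idx q → group q₀ ≡ group p₀ + h →
      InClosedMinus r q (idx p₀) → InClosedMinus r q (idx q₀) →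
      group r ≡ group p₀ × group q ≡ group q₀ × idx r ≤ idx p₀ × idx q₀ ≤ idx q
    closedMinus-near-opposite p₀ q₀ r q r<q q₀≡ p₀∈ q₀∈ with gd r q ≤? h
    ... | yes near with closedMinus-near r q r<q near p₀∈ | closedMinus-near r q r<q near q₀∈
    ...   | r≤p₀ , _ | _ , q₀≤q
      with squeeze (idx≤⇒group≤ {r} {p₀} r≤p₀)
                   (subst (_≤ group q) q₀≡ (idx≤⇒group≤ {q₀} {q} q₀≤q))
                   (near-span r q near)
    ...   | r≡p₀ , q≡r+h = r≡p₀ , trans q≡r+h (trans (cong (_+ h) r≡p₀) (sym q₀≡)) , r≤p₀ , q₀≤q
    closedMinus-near-opposite p₀ q₀ r q r<q q₀≡ p₀∈ q₀∈ | no ¬near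
      with far-closedMinus-straddling r q r<q (≰⇒> ¬near) (straddling p₀ q₀ ≤-refl q₀≡) p₀∈ q₀∈
    ... | p₀≤r , q≤q₀ = contradiction (far-span r q r<q (≰⇒> ¬near)) (≤⇒≯ (begin
      group q       ≤⟨ idx≤⇒group≤ {q} {q₀} q≤q₀ ⟩
      group q₀      ≡⟨ q₀≡ ⟩
      group p₀ + h  ≤⟨ +-monoˡ-≤ h (idx≤⇒group≤ {p₀} {r} p₀≤r) ⟩
      group r + h   ∎))
      where open ≤-Reasoning

    closedMinus-far-opposite : ∀ p₀ q₀ r q → idx r < idx q → group q₀ ≡ group p₀ + suc h →
      InClosedMinus r q (idx p₀) → InClosedMinus r q (idx q₀) →
      group r ≡ group p₀ × group q ≡ group q₀ × idx p₀ ≤ idx r × idx q ≤ idx q₀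
    closedMinus-far-opposite p₀ q₀ r q r<q q₀≡ p₀∈ q₀∈ with gd r q ≤? h
    ... | yes near with closedMinus-near r q r<q near p₀∈ | closedMinus-near r q r<q near q₀∈
    ...   | r≤p₀ , _ | _ , q₀≤q = contradiction (begin-strict
      group p₀ + h      <⟨ +-monoʳ-< (group p₀) ≤-refl ⟩
      group p₀ + suc h  ≡⟨ q₀≡ ⟨
      group q₀          ≤⟨ idx≤⇒group≤ {q₀} {q} q₀≤q ⟩
      group q           ≤⟨ near-span r q near ⟩
      group r + h       ∎) (≤⇒≯ (+-monoˡ-≤ h (idx≤⇒group≤ {r} {p₀} r≤p₀)))
      where open ≤-Reasoning
    closedMinus-far-opposite p₀ q₀ r q r<q q₀≡ p₀∈ q₀∈ | no ¬near
      with far-closedMinus-straddling r q r<q (≰⇒> ¬near) (straddling p₀ q₀ (n≤1+n h) q₀≡) p₀∈ q₀∈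
    ... | p₀≤r , q≤q₀
      with squeeze (idx≤⇒group≤ {p₀} {r} p₀≤r)
                   (subst (_≤ group q) (sym (+-suc (group r) h)) (far-span r q r<q (≰⇒> ¬near)))
                   (subst (group q ≤_) q₀≡ (idx≤⇒group≤ {q} {q₀} q≤q₀))
    ... | p₀≡r , q≡p₀+1+h = sym p₀≡r , trans q≡p₀+1+h (sym q₀≡) , p₀≤r , q≤q₀

    module _ {a b : Fin k} (B : Bundle a b) where
      open Bundle B

      dist-edge-≥ : ∀ t s d → toℕ t + d ≤ toℕ s → h * ℓ + d ≤ dist (edge (t , s))
      dist-edge-≥ t s d t+d≤s = +-cancelʳ-≤ (toℕ t) (h * ℓ + d) (dist (edge (t , s))) (begin
        h * ℓ + d + toℕ t          ≡⟨ +-assoc (h * ℓ) d (toℕ t) ⟩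
        h * ℓ + (d + toℕ t)        ≡⟨ cong (h * ℓ +_) (+-comm d (toℕ t)) ⟩
        h * ℓ + (toℕ t + d)        ≤⟨ +-monoʳ-≤ (h * ℓ) t+d≤s ⟩
        h * ℓ + toℕ s              ≡⟨ dist-edge t s ⟨
        dist (edge (t , s)) + toℕ t ∎)
        where open ≤-Reasoning

      edge-diagonal : ∀ t s → toℕ t ≤ toℕ s → Diagonal (edge (t , s))
      edge-diagonal t s t≤s = Connects⇒NonRadial _ (connects (t , s)) , λ boundary → <⇒≱ hℓ≥2 (begin
        h * ℓ                ≤⟨ m≤m+n (h * ℓ) 0 ⟩
        h * ℓ + 0            ≤⟨ dist-edge-≥ t s 0 (subst (_≤ toℕ s) (sym (+-identityʳ (toℕ t))) t≤s) ⟩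
        dist (edge (t , s))  ≡⟨ boundary⇒dist≡1 _ boundary ⟩
        1                    ∎)
        where open ≤-Reasoning

      module _ {m} (c : Edge → Fin m) (plane : PlaneColouring c) {i} (i≤ℓ : i ≤ ℓ) where

        ℓ∸i+j<ℓ : (j : Fin i) → ℓ ∸ i + toℕ j < ℓ
        ℓ∸i+j<ℓ j = subst (ℓ ∸ i + toℕ j <_) (m∸n+n≡m i≤ℓ) (+-monoʳ-< (ℓ ∸ i) (toℕ<n j))

        seed : Fin i → Fin ℓ × Fin ℓ
        seed j = inject≤ j i≤ℓ , fromℕ< (ℓ∸i+j<ℓ j)

        seeds-cross : ∀ {j j′} → toℕ j < toℕ j′ → Cross (edge (seed j)) (edge (seed j′))
        seeds-cross {j} {j′} j<j′ = crossing
          (subst₂ _<_ (sym (toℕ-inject≤ j i≤ℓ)) (sym (toℕ-inject≤ j′ i≤ℓ)) j<j′)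
          (subst₂ _<_ (sym (toℕ-fromℕ< (ℓ∸i+j<ℓ j))) (sym (toℕ-fromℕ< (ℓ∸i+j<ℓ j′))) (+-monoʳ-< (ℓ ∸ i) j<j′))

        seed-colour-injective : ∀ {j j′} → c (edge (seed j)) ≡ c (edge (seed j′)) → j ≡ j′
        seed-colour-injective {j} {j′} same with FP.<-cmp j j′
        ... | tri< j<j′ _ _ = contradiction (seeds-cross j<j′) (plane _ _ same)
        ... | tri≈ _ j≡j′ _ = j≡j′
        ... | tri> _ _ j′<j = contradiction (seeds-cross j′<j) (plane _ _ (sym same))

        SameColour : Fin i → Fin ℓ × Fin ℓ → Set
        SameColour j y = c (edge y) ≡ c (edge (seed j))

        climb : ∀ j → ∃ λ y → seed j ⊑ y × SameColour j y × ¬ (∃ λ z → y ⊏ z × SameColour j z)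
        climb j = ascend (λ x → ∃-interval? λ y → (x ⊏? y) ×-dec (c (edge y) FP.≟ c (edge (seed j)))) refl

        top : Fin i → Fin ℓ × Fin ℓ
        top j = proj₁ (climb j)

        seed⊑top : ∀ j → seed j ⊑ top j
        seed⊑top j = proj₁ (proj₂ (climb j))

        top-colour : ∀ j → SameColour j (top j)
        top-colour j = proj₁ (proj₂ (proj₂ (climb j)))

        top-maximal : ∀ j → ¬ (∃ λ z → top j ⊏ z × SameColour j z)
        top-maximal j = proj₂ (proj₂ (proj₂ (climb j)))

        top-wide : ∀ j → toℕ (proj₁ (top j)) + (ℓ ∸ i) ≤ toℕ (proj₂ (top j))
        top-wide j = begin
          toℕ (proj₁ (top j)) + (ℓ ∸ i)
            ≤⟨ +-monoˡ-≤ (ℓ ∸ i) (≤-trans (proj₁ (seed⊑top j)) (≤-reflexive (toℕ-inject≤ j i≤ℓ))) ⟩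
          toℕ j + (ℓ ∸ i)       ≡⟨ +-comm (toℕ j) (ℓ ∸ i) ⟩
          ℓ ∸ i + toℕ j         ≡⟨ toℕ-fromℕ< (ℓ∸i+j<ℓ j) ⟨
          toℕ (proj₂ (seed j))  ≤⟨ proj₂ (seed⊑top j) ⟩
          toℕ (proj₂ (top j))   ∎
          where open ≤-Reasoning

        chosen : Fin i → Edge
        chosen j = edge (top j)

        chosen-injective : Injective _≡_ _≡_ chosen
        chosen-injective {j} {j′} eq = seed-colour-injective (begin
          c (edge (seed j))   ≡⟨ top-colour j ⟨
          c (chosen j)        ≡⟨ cong c eq ⟩
          c (chosen j′)       ≡⟨ top-colour j′ ⟩
          c (edge (seed j′))  ∎)
          where open ≡-Reasoning

        chosen-diagonal : ∀ j → Diagonal (chosen j)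
        chosen-diagonal j = edge-diagonal _ _ (≤-trans (m≤m+n _ (ℓ ∸ i)) (top-wide j))

        chosen-long : ∀ j → suc h * ℓ ∸ i ≤ dist (chosen j)
        chosen-long j = subst (_≤ dist (chosen j)) bound (dist-edge-≥ _ _ (ℓ ∸ i) (top-wide j))
          where
          bound : h * ℓ + (ℓ ∸ i) ≡ suc h * ℓ ∸ i
          bound = trans (sym (+-∸-assoc (h * ℓ) i≤ℓ)) (cong (_∸ i) (+-comm (h * ℓ) ℓ))

        chosen-maximal : ∀ j → Maximal c (chosen j)
        chosen-maximal j (e , _ , same , chosen<e) with <c-edge (top j) e chosen<e
        ... | y , top⊏y , refl = top-maximal j (y , top⊏y , trans same (top-colour j))

        long-maximal-diagonals : LongMaximalDiagonals c a b i
        long-maximal-diagonals = chosen , chosen-injective ,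
          λ j → chosen-diagonal j , connects (top j) , chosen-long j , chosen-maximal j

    near-bundle : ∀ {a b} → toℕ b ≡ toℕ a + h → Bundle a b
    near-bundle {a} {b} b≡a+h = record
      { edge = edge ; connects = λ _ → inj₁ (refl , refl) ; dist-edge = dist-edge
      ; crossing = λ t<t′ s<s′ → inj₁ (+-monoʳ-< (toℕ a * ℓ) t<t′ , group<⇒idx< a<b , +-monoʳ-< (toℕ b * ℓ) s<s′)
      ; <c-edge = <c-edge }
      where
      a<b : toℕ a < toℕ b
      a<b = subst (toℕ a <_) (sym b≡a+h) (m<m+n (toℕ a) h≥1)

      edge : Fin ℓ × Fin ℓ → Edge
      edge (t , s) = chord (a , t) (b , s) (group<⇒idx< a<b)

      near : ∀ t s → gd (a , t) (b , s) ≤ h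
      near t s = ≤-reflexive (trans (cong (_∸ toℕ a) b≡a+h) (m+n∸m≡n (toℕ a) h))

      dist-edge : ∀ t s → dist (edge (t , s)) + toℕ t ≡ h * ℓ + toℕ s
      dist-edge t s = +-cancelˡ-≡ (toℕ a * ℓ) _ _ (begin
        toℕ a * ℓ + (D + toℕ t)      ≡⟨ x∙yz≈y∙xz (toℕ a * ℓ) D (toℕ t) ⟩
        D + (toℕ a * ℓ + toℕ t)      ≡⟨ dist-near (a , t) (b , s) (group<⇒idx< a<b) (near t s) ⟩
        toℕ b * ℓ + toℕ s            ≡⟨ cong (λ g → g * ℓ + toℕ s) b≡a+h ⟩
        (toℕ a + h) * ℓ + toℕ s      ≡⟨ cong (_+ toℕ s) (*-distribʳ-+ ℓ (toℕ a) h) ⟩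
        toℕ a * ℓ + h * ℓ + toℕ s    ≡⟨ +-assoc (toℕ a * ℓ) (h * ℓ) (toℕ s) ⟩
        toℕ a * ℓ + (h * ℓ + toℕ s)  ∎)
        where
        open ≡-Reasoning
        D : ℕ
        D = dist (edge (t , s))

      <c-edge : ∀ x e → edge x <c e → ∃ λ y → x ⊏ y × e ≡ edge y
      <c-edge (t , s) (chord (g , t′) (g′ , s′) r<q) (p∈ , q∈ , distinct)
        with closedMinus-near-opposite (a , t) (b , s) (g , t′) (g′ , s′) r<q b≡a+h p∈ q∈
      ... | g≡a , g′≡b , r≤p , q₀≤q
        with toℕ-injective {i = g} {j = a} g≡a | toℕ-injective {i = g′} {j = b} g′≡b
      ... | refl | refl =
        (t′ , s′) , ((+-cancelˡ-≤ _ _ _ r≤p , +-cancelˡ-≤ _ _ _ q₀≤q) , λ { refl → distinct (refl , refl) }) ,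
        cong (chord _ _) (<-irrelevant _ _)

    far-bundle : ∀ {a b} → toℕ b ≡ toℕ a + suc h → Bundle a b
    far-bundle {a} {b} b≡a+1+h = record
      { edge = edge ; connects = λ _ → inj₁ (refl , refl) ; dist-edge = dist-edge
      ; crossing = λ t<t′ s<s′ → inj₁ (+-monoʳ-< (toℕ a * ℓ) s<s′ , group<⇒idx< a<b , +-monoʳ-< (toℕ b * ℓ) t<t′)
      ; <c-edge = <c-edge }
      where
      a<b : toℕ a < toℕ b
      a<b = subst (toℕ a <_) (sym b≡a+1+h) (m<m+n (toℕ a) z<s)

      -- e⁻ is now the outer arc, which runs from b round to a, so t indexes group b.
      edge : Fin ℓ × Fin ℓ → Edge
      edge (t , s) = chord (a , s) (b , t) (group<⇒idx< a<b)

      far : ∀ t s → h < gd (a , s) (b , t)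
      far t s = ≤-reflexive (sym (trans (cong (_∸ toℕ a) b≡a+1+h) (m+n∸m≡n (toℕ a) (suc h))))

      dist-edge : ∀ t s → dist (edge (t , s)) + toℕ t ≡ h * ℓ + toℕ s
      dist-edge t s = +-cancelˡ-≡ (toℕ b * ℓ) _ _ (begin
        toℕ b * ℓ + (D + toℕ t)                    ≡⟨ x∙yz≈y∙xz (toℕ b * ℓ) D (toℕ t) ⟩
        D + (toℕ b * ℓ + toℕ t)                    ≡⟨ dist-far (a , s) (b , t) (group<⇒idx< a<b) (far t s) ⟩
        toℕ a * ℓ + toℕ s + k * ℓ                  ≡⟨ cong (toℕ a * ℓ + toℕ s +_) N≡ ⟩
        toℕ a * ℓ + toℕ s + (suc h * ℓ + h * ℓ)    ≡⟨ interchange (toℕ a * ℓ) (toℕ s) (suc h * ℓ) (h * ℓ) ⟩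
        toℕ a * ℓ + suc h * ℓ + (toℕ s + h * ℓ)    ≡⟨ cong₂ _+_ (*-distribʳ-+ ℓ (toℕ a) (suc h)) (+-comm (h * ℓ) (toℕ s)) ⟨
        (toℕ a + suc h) * ℓ + (h * ℓ + toℕ s)      ≡⟨ cong (λ g → g * ℓ + (h * ℓ + toℕ s)) b≡a+1+h ⟨
        toℕ b * ℓ + (h * ℓ + toℕ s)                ∎)
        where
        open ≡-Reasoning
        D : ℕ
        D = dist (edge (t , s))

      <c-edge : ∀ x e → edge x <c e → ∃ λ y → x ⊏ y × e ≡ edge y
      <c-edge (t , s) (chord (g , s′) (g′ , t′) r<q) (p∈ , q∈ , distinct)
        with closedMinus-far-opposite (a , s) (b , t) (g , s′) (g′ , t′) r<q b≡a+1+h p∈ q∈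
      ... | g≡a , g′≡b , p≤r , q≤q₀
        with toℕ-injective {i = g} {j = a} g≡a | toℕ-injective {i = g′} {j = b} g′≡b
      ... | refl | refl =
        (t′ , s′) , ((+-cancelˡ-≤ _ _ _ q≤q₀ , +-cancelˡ-≤ _ _ _ p≤r) , λ { refl → distinct (refl , refl) }) ,
        cong (chord _ _) (<-irrelevant _ _)

    ordered-bundle : ∀ {a b} → toℕ a ≤ toℕ b → Opposite a b → Bundle a b
    ordered-bundle a≤b (inj₁ ∣a-b∣≡h)   = near-bundle (∣m-n∣≡d⇒n≡m+d a≤b ∣a-b∣≡h)
    ordered-bundle a≤b (inj₂ ∣a-b∣≡1+h) = far-bundle (∣m-n∣≡d⇒n≡m+d a≤b ∣a-b∣≡1+h)

    opposite-bundle : ∀ {a b} → Opposite a b → Bundle a b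
    opposite-bundle {a} {b} opp with ≤-total (toℕ a) (toℕ b)
    ... | inj₁ a≤b = ordered-bundle a≤b opp
    ... | inj₂ b≤a = Bundle-sym (ordered-bundle b≤a (map-⊎ (trans ∣b-a∣≡∣a-b∣) (trans ∣b-a∣≡∣a-b∣) opp))
      where
      ∣b-a∣≡∣a-b∣ : ∣ toℕ b - toℕ a ∣ ≡ ∣ toℕ a - toℕ b ∣
      ∣b-a∣≡∣a-b∣ = ∣-∣-comm (toℕ b) (toℕ a)

proposition20 : (k ℓ : ℕ) → Odd k → Odd ℓ → 3 ≤ k → 3 ≤ ℓ →
    (c : BW.Edge k ℓ → Fin (BW.n k ℓ)) → BW.PlaneColouring k ℓ c →
    (a b : Fin k) → BW.Opposite k ℓ a b →
    (i : ℕ) → 1 ≤ i → i ≤ ℓ →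
    Σ (Fin i → BW.Edge k ℓ) (λ f → Injective _≡_ _≡_ f ×
      ((j : Fin i) → BW.Diagonal k ℓ (f j) × BW.Connects k ℓ a b (f j)
        × (suc (BW.h k ℓ) * ℓ ∸ i ≤ BW.dist k ℓ (f j)) × BW.Maximal k ℓ c (f j)))
proposition20 k ℓ odd-k _ 3≤k 3≤ℓ c plane a b opp i _ i≤ℓ =
  long-maximal-diagonals (opposite-bundle opp) c plane i≤ℓ
  where
  k≡1+2h : k ≡ suc (BW.h k ℓ + BW.h k ℓ)
  k≡1+2h = odd⇒≡1+2⌊/2⌋ odd-k
  open Geometry.Opposite k ℓ k≡1+2h (3≤1+n+n⇒1≤n (BW.h k ℓ) (subst (3 ≤_) k≡1+2h 3≤k))
                                  (≤-trans (n≤1+n 2) 3≤ℓ)
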